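{- Let $G$ be a signed graph with vertices $v_1,\dots,v_n$, and let $H_1,\dots,H_n$ be signed graphs such that $\chi_{H_1}(\lambda)=\dots=\chi_{H_n}(\lambda)=\chi_{H'}(\lambda)$ for some signed graph $H'$. Then $$f_{G\circ\Lambda_{l=1}^{n}H_l}(\lambda)=\Big(\prod_{l=1}^{n}f_{H_l}(\lambda)\Big)\cdot f_{G}\big(\lambda-\chi_{H'}(\lambda)\big).$$
   Context: A signed graph $G=(V,E,\sigma)$ is a finite simple graph with signature $\sigma:E\to\{+1,-1\}$, considered with its canonical marking $\mu(v)=\prod_{e\ni v}\sigma(e)$ (product over incident edges; empty product $=+1$); $\mu[V]$ is the column vector of markings. $A(G)$ is the signed adjacency matrix, $f_G(\lambda)=\det(\lambda I-A(G))$, and $\chi_H(\lambda)=\mu[V]^T(\lambda I-A(H))^{ -1}\mu[V]$ is the signed coronal. Generalized corona product: $G\circ\Lambda_{l=1}^{n}H_l$ is obtained from the disjoint union of $G,H_1,\dots,H_n$ by adding, for each $l$, an edge from $v_l$ to every vertex $w$ of $H_l$ with sign $\mu(v_l)\mu_l(w)$, where $\mu,\mu_l$ are the canonical markings of $G,H_l$. -}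

module Defs where

open import Data.Nat using (ℕ; zero; suc)
open import Data.Fin using (Fin; zero; suc; punchIn; toℕ; splitAt; _≟_)
open import Data.Sum using (_⊎_; inj₁; inj₂)
open import Data.Product using (Σ; _,_)
open import Data.Maybe using (Maybe; just; nothing)
open import Data.Sign using (Sign) renaming (_*_ to _*ˢ_)
open import Data.Rational using (ℚ; 0ℚ; 1ℚ; _+_; _*_; _-_; -_; _÷_; ≢-nonZero)
open import Relation.Binary.PropositionalEquality using (_≡_; _≢_; refl)
open import Relation.Nullary using (yes; no)

EdgeFun : ℕ → Set
EdgeFun n = Fin n → Fin n → Maybe Sign

record SignedGraph (n : ℕ) : Set where
  field
    edge      : EdgeFun n
    symmetric : ∀ i j → edge i j ≡ edge j i
    loopless  : ∀ i → edge i i ≡ nothing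
open SignedGraph public

∑ : ∀ {n} → (Fin n → ℚ) → ℚ
∑ {zero}  f = 0ℚ
∑ {suc n} f = f zero + ∑ (λ i → f (suc i))

∏ : ∀ {n} → (Fin n → ℚ) → ℚ
∏ {zero}  f = 1ℚ
∏ {suc n} f = f zero * ∏ (λ i → f (suc i))

∏ˢ : ∀ {n} → (Fin n → Sign) → Sign
∏ˢ {zero}  f = Sign.+
∏ˢ {suc n} f = f zero *ˢ ∏ˢ (λ i → f (suc i))

edgeSign : Maybe Sign → Sign
edgeSign nothing  = Sign.+
edgeSign (just s) = s

marking : ∀ {n} → EdgeFun n → Fin n → Sign
marking e v = ∏ˢ (λ j → edgeSign (e v j))

signℚ : Sign → ℚ
signℚ Sign.+ = 1ℚ
signℚ Sign.- = - 1ℚ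

Matrix : ℕ → Set
Matrix n = Fin n → Fin n → ℚ

entry : Maybe Sign → ℚ
entry nothing  = 0ℚ
entry (just s) = signℚ s

adjacency : ∀ {n} → EdgeFun n → Matrix n
adjacency e i j = entry (e i j)

altSign : ℕ → ℚ
altSign zero          = 1ℚ
altSign (suc zero)    = - 1ℚ
altSign (suc (suc k)) = altSign k

minor : ∀ {n} → Fin (suc n) → Fin (suc n) → Matrix (suc n) → Matrix n
minor r c M i k = M (punchIn r i) (punchIn c k)

det : ∀ {n} → Matrix n → ℚ
det {zero}  M = 1ℚ
det {suc n} M = ∑ (λ j → altSign (toℕ j) * (M zero j * det (minor zero j M)))

adj : ∀ {n} → Matrix n → Matrix n
adj {zero}  M ()
adj {suc n} M i j = altSign (toℕ i Data.Nat.+ toℕ j) * det (minor j i M)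

identityTimes : ∀ {n} → ℚ → Matrix n
identityTimes x i j with i ≟ j
... | yes _ = x
... | no  _ = 0ℚ

charMatrix : ∀ {n} → EdgeFun n → ℚ → Matrix n
charMatrix e x i j = identityTimes x i j - adjacency e i j

charPolyE : ∀ {n} → EdgeFun n → ℚ → ℚ
charPolyE e x = det (charMatrix e x)

charPoly : ∀ {n} → SignedGraph n → ℚ → ℚ
charPoly G = charPolyE (edge G)

-- signed coronal χ_H(x) = μᵀ (x I - A)⁻¹ μ, with (xI-A)⁻¹ = adj(xI-A)/det(xI-A);
-- defined at x whenever f_H(x) ≠ 0.
coronal : ∀ {m} (H : SignedGraph m) (x : ℚ) → charPoly H x ≢ 0ℚ → ℚ
coronal {m} H x nz =
  (∑ (λ i → ∑ (λ j → μ i * (adj (charMatrix (edge H) x) i j * μ j))))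
    ÷ charPoly H x
  where
    μ : Fin m → ℚ
    μ v = signℚ (marking (edge H) v)
    instance
      nz' = ≢-nonZero nz

-- Generalized corona product G ∘ Λ_{l} H_l.
-- Vertex set: Fin (n + total n m); the first n vertices are those of G
-- (vertex v_l = l), followed by the vertices of H_0, H_1, ..., H_{n-1} in order.

total : (n : ℕ) → (Fin n → ℕ) → ℕ
total zero    m = 0
total (suc n) m = m zero Data.Nat.+ total n (λ l → m (suc l))

decodeH : (n : ℕ) (m : Fin n → ℕ) → Fin (total n m) → Σ (Fin n) (λ l → Fin (m l))
decodeH (suc n) m i with splitAt (m zero) i
... | inj₁ w = zero , w
... | inj₂ k with decodeH n (λ l → m (suc l)) k
...   | l , w = suc l , w

CVertex : (n : ℕ) → (Fin n → ℕ) → Set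
CVertex n m = Fin n ⊎ Σ (Fin n) (λ l → Fin (m l))

decode : (n : ℕ) (m : Fin n → ℕ) → Fin (n Data.Nat.+ total n m) → CVertex n m
decode n m x with splitAt n x
... | inj₁ v = inj₁ v
... | inj₂ k = inj₂ (decodeH n m k)

coronaEdgeV : ∀ {n} {m : Fin n → ℕ} → SignedGraph n → ((l : Fin n) → SignedGraph (m l))
            → CVertex n m → CVertex n m → Maybe Sign
coronaEdgeV G H (inj₁ i) (inj₁ j) = edge G i j
coronaEdgeV G H (inj₁ i) (inj₂ (l , w)) with i ≟ l
... | yes _ = just (marking (edge G) i *ˢ marking (edge (H l)) w)
... | no  _ = nothing
coronaEdgeV G H (inj₂ (l , w)) (inj₁ i) with i ≟ l
... | yes _ = just (marking (edge G) i *ˢ marking (edge (H l)) w)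
... | no  _ = nothing
coronaEdgeV G H (inj₂ (l , w)) (inj₂ (l' , w')) with l ≟ l'
... | yes refl = edge (H l) w w'
... | no  _    = nothing

corona : ∀ {n} {m : Fin n → ℕ} → SignedGraph n → ((l : Fin n) → SignedGraph (m l))
       → EdgeFun (n Data.Nat.+ total n m)
corona {n} {m} G H x y = coronaEdgeV G H (decode n m x) (decode n m y)

{-# OPTIONS --safe #-}
module Submission where

-- Order the vertices of the corona as v₁, …, vₙ followed by the blocks H₁, …, Hₙ.  Then
-- λI − A is the block matrix [[λI − A(G), −B], [−Bᵀ, D]] with D block diagonal with blocks
-- λI − A(H_l), and B joins v_l to w ∈ H_l with weight μ(v_l) μ_l(w).  Adding to the G-columns
-- the combinations of H-columns given by D⁻¹Bᵀ (which does not change the determinant) clears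
-- the lower-left block, so the determinant is det D = ∏ f_{H_l}(λ) times the determinant of
-- the Schur complement λI − A(G) − B D⁻¹ Bᵀ.  Since v_l is joined to H_l only, B D⁻¹ Bᵀ is
-- diagonal with entries μ(v_l)² μ_lᵀ (λI − A(H_l))⁻¹ μ_l = χ_{H_l}(λ) = χ_{H'}(λ), so the
-- Schur complement is λI − χ_{H'}(λ) I − A(G).

open import Defs
open import Algebra.Bundles using (CommutativeRing)
import Algebra.Properties.Semiring.Sum as SemiringSum
open import Data.Empty using (⊥-elim)
open import Data.Fin as Fin using (Fin; zero; suc; punchIn; punchOut; toℕ; _↑ˡ_; _↑ʳ_; splitAt)
import Data.Fin.Properties as Fin
open import Data.Maybe using (Maybe; nothing)
open import Data.Nat as ℕ using (ℕ; zero; suc)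
import Data.Nat.Properties as ℕ
open import Data.Product using (Σ; _×_; _,_; ∃-syntax)
open import Data.Product.Properties using (,-injectiveˡ)
open import Data.Rational using (ℚ; 0ℚ; 1ℚ; _+_; _*_; _-_; -_; 1/_; ≢-nonZero)
open import Data.Rational.Properties
  using ( +-*-commutativeRing; +-identityˡ; +-identityʳ; +-assoc; *-zeroˡ; *-zeroʳ; *-identityˡ; *-identityʳ
        ; *-inverseˡ; *-comm; *-assoc; *-distribʳ-+; neg-distribˡ-*)
open import Data.Rational.Solver using (module +-*-Solver)
open import Data.Sign using (Sign) renaming (_*_ to _*ˢ_)
open import Data.Sum using (_⊎_; inj₁; inj₂)
open import Function using (_∘_)
open import Relation.Binary.PropositionalEquality
open import Relation.Nullary using (¬_; Dec; yes; no)

open +-*-Solver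
open ≡-Reasoning

module Sum = SemiringSum (CommutativeRing.semiring +-*-commutativeRing)
open Sum using (sum)

∑≡sum : ∀ {n} (f : Fin n → ℚ) → ∑ f ≡ sum f
∑≡sum {zero}  f = refl
∑≡sum {suc n} f = cong (f zero +_) (∑≡sum (f ∘ suc))

∑-cong : ∀ {n} {f g : Fin n → ℚ} → f ≗ g → ∑ f ≡ ∑ g
∑-cong {zero}  f≗g = refl
∑-cong {suc n} f≗g = cong₂ _+_ (f≗g zero) (∑-cong (f≗g ∘ suc))

∑-zero : ∀ {n} {f : Fin n → ℚ} → (∀ i → f i ≡ 0ℚ) → ∑ f ≡ 0ℚ
∑-zero {n} f≡0 = trans (∑-cong f≡0) (trans (∑≡sum {n} (λ _ → 0ℚ)) (Sum.sum-replicate-zero n))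

∑-distrib-+ : ∀ {n} (f g : Fin n → ℚ) → ∑ (λ i → f i + g i) ≡ ∑ f + ∑ g
∑-distrib-+ f g =
  trans (∑≡sum (λ i → f i + g i)) (trans (Sum.∑-distrib-+ f g) (sym (cong₂ _+_ (∑≡sum f) (∑≡sum g))))

∑²≡sum² : ∀ {m n} (f : Fin m → Fin n → ℚ) → ∑ (λ i → ∑ (f i)) ≡ sum (λ i → sum (f i))
∑²≡sum² f = trans (∑-cong (λ i → ∑≡sum (f i))) (∑≡sum (λ i → sum (f i)))

∑-comm : ∀ {m n} (f : Fin m → Fin n → ℚ) → ∑ (λ i → ∑ (f i)) ≡ ∑ (λ j → ∑ (λ i → f i j))
∑-comm f = trans (∑²≡sum² f) (trans (Sum.∑-comm f) (sym (∑²≡sum² (λ j i → f i j))))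

*-distribˡ-∑ : ∀ {n} c (f : Fin n → ℚ) → c * ∑ f ≡ ∑ (λ i → c * f i)
*-distribˡ-∑ c f = trans (cong (c *_) (∑≡sum f)) (trans (Sum.*-distribˡ-sum c f) (sym (∑≡sum (λ i → c * f i))))

*-distribʳ-∑ : ∀ {n} c (f : Fin n → ℚ) → ∑ f * c ≡ ∑ (λ i → f i * c)
*-distribʳ-∑ c f = trans (cong (_* c) (∑≡sum f)) (trans (Sum.*-distribʳ-sum c f) (sym (∑≡sum (λ i → f i * c))))

∑-remove : ∀ {n} (f : Fin (suc n) → ℚ) c → ∑ f ≡ f c + ∑ (f ∘ punchIn c)
∑-remove f c = trans (∑≡sum f) (trans (Sum.sum-remove {i = c} f) (cong (f c +_) (sym (∑≡sum (f ∘ punchIn c)))))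

∑-single : ∀ {n} (f : Fin n → ℚ) c → (∀ i → i ≢ c → f i ≡ 0ℚ) → ∑ f ≡ f c
∑-single {suc n} f c f≡0 = begin
  ∑ f                      ≡⟨ ∑-remove f c ⟩
  f c + ∑ (f ∘ punchIn c)  ≡⟨ cong (f c +_) (∑-zero (λ j → f≡0 _ (Fin.punchInᵢ≢i c j))) ⟩
  f c + 0ℚ                 ≡⟨ +-identityʳ (f c) ⟩
  f c                      ∎

∑-splitAt : ∀ a {b} (f : Fin (a ℕ.+ b) → ℚ) → ∑ f ≡ ∑ (λ i → f (i ↑ˡ b)) + ∑ (λ j → f (a ↑ʳ j))
∑-splitAt zero    f = sym (+-identityˡ (∑ f))
∑-splitAt (suc a) f = trans (cong (f zero +_) (∑-splitAt a (f ∘ suc))) (sym (+-assoc (f zero) _ _))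

altSign-suc : ∀ k → altSign (suc k) ≡ - altSign k
altSign-suc zero          = refl
altSign-suc (suc zero)    = refl
altSign-suc (suc (suc k)) = altSign-suc k

altSign-+ : ∀ a b → altSign (a ℕ.+ b) ≡ altSign a * altSign b
altSign-+ zero    b = sym (*-identityˡ (altSign b))
altSign-+ (suc a) b = begin
  altSign (suc (a ℕ.+ b))    ≡⟨ altSign-suc (a ℕ.+ b) ⟩
  - altSign (a ℕ.+ b)        ≡⟨ cong -_ (altSign-+ a b) ⟩
  - (altSign a * altSign b)  ≡⟨ neg-distribˡ-* (altSign a) (altSign b) ⟩
  - altSign a * altSign b    ≡⟨ cong (_* altSign b) (altSign-suc a) ⟨
  altSign (suc a) * altSign b ∎

sgn : ∀ {n} → Fin n → ℚ
sgn i = altSign (toℕ i)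

sgn-punchIn-punchOut : ∀ {n} (c : Fin (suc (suc n))) j (c≢ : punchIn c j ≢ c) →
                       sgn (punchIn c j) * sgn (punchOut c≢) ≡ - (sgn c * sgn j)
sgn-punchIn-punchOut zero j _ = begin
  altSign (suc (toℕ j)) * 1ℚ ≡⟨ cong (_* 1ℚ) (altSign-suc (toℕ j)) ⟩
  - sgn j * 1ℚ               ≡⟨ solve 1 (λ s → :- s :* con 1ℚ := :- (con 1ℚ :* s)) refl (sgn j) ⟩
  - (1ℚ * sgn j)             ∎
sgn-punchIn-punchOut (suc c) zero _ = begin
  1ℚ * sgn c                      ≡⟨ solve 1 (λ s → con 1ℚ :* s := :- (:- s :* con 1ℚ)) refl (sgn c) ⟩
  - (- sgn c * 1ℚ)                ≡⟨ cong (λ s → - (s * 1ℚ)) (altSign-suc (toℕ c)) ⟨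
  - (altSign (suc (toℕ c)) * 1ℚ)  ∎
sgn-punchIn-punchOut {suc n} (suc c) (suc j) c≢ = begin
  altSign (suc (toℕ (punchIn c j))) * altSign (suc (toℕ (punchOut c≢′)))
    ≡⟨ cong₂ _*_ (altSign-suc (toℕ (punchIn c j))) (altSign-suc (toℕ (punchOut c≢′))) ⟩
  - sgn (punchIn c j) * - sgn (punchOut c≢′)  ≡⟨ neg-*-neg (sgn (punchIn c j)) (sgn (punchOut c≢′)) ⟩
  sgn (punchIn c j) * sgn (punchOut c≢′)      ≡⟨ sgn-punchIn-punchOut c j c≢′ ⟩
  - (sgn c * sgn j)                           ≡⟨ cong -_ (neg-*-neg (sgn c) (sgn j)) ⟨
  - (- sgn c * - sgn j)
    ≡⟨ cong₂ (λ s t → - (s * t)) (altSign-suc (toℕ c)) (altSign-suc (toℕ j)) ⟨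
  - (altSign (suc (toℕ c)) * altSign (suc (toℕ j))) ∎
  where
  c≢′ : punchIn c j ≢ c
  c≢′ = c≢ ∘ cong suc
  neg-*-neg : ∀ p q → - p * - q ≡ p * q
  neg-*-neg = solve 2 (λ p q → :- p :* :- q := p :* q) refl

punchIn-exchange : ∀ {n} (c : Fin (suc (suc n))) j (c≢ : punchIn c j ≢ c) k →
                   punchIn (punchIn c j) (punchIn (punchOut c≢) k) ≡ punchIn c (punchIn j k)
punchIn-exchange zero    j       c≢ k       = refl
punchIn-exchange (suc c) zero    c≢ k       = refl
punchIn-exchange {suc n} (suc c) (suc j) c≢ zero    = refl
punchIn-exchange {suc n} (suc c) (suc j) c≢ (suc k) = cong suc (punchIn-exchange c j (c≢ ∘ cong suc) k)

det-cong : ∀ {n} {M N : Matrix n} → (∀ i j → M i j ≡ N i j) → det M ≡ det N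
det-cong {zero}  M≡N = refl
det-cong {suc n} M≡N = ∑-cong λ j →
  cong₂ (λ a d → sgn j * (a * d)) (M≡N zero j) (det-cong (λ i k → M≡N (suc i) (punchIn j k)))

cofactor : ∀ {n} → Matrix (suc n) → Fin (suc n) → Fin (suc n) → ℚ
cofactor M i j = altSign (toℕ i ℕ.+ toℕ j) * det (minor i j M)

det-expandColumn : ∀ {n} (M : Matrix (suc n)) c → det M ≡ ∑ (λ i → M i c * cofactor M i c)
det-expandColumn {zero} M zero =
  cong (_+ 0ℚ) (solve 2 (λ a d → con 1ℚ :* (a :* d) := a :* (con 1ℚ :* d)) refl (M zero zero) 1ℚ)
det-expandColumn {suc n} M c = begin
  det M                                                 ≡⟨ ∑-remove rowTerm c ⟩
  rowTerm c + ∑ (rowTerm ∘ punchIn c)                   ≡⟨ cong₂ _+_ firstRow otherRows ⟩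
  M zero c * cofactor M zero c
    + ∑ (λ i → M (suc i) c * cofactor M (suc i) c)      ∎
  where
  rowTerm : Fin (suc (suc n)) → ℚ
  rowTerm j = sgn j * (M zero j * det (minor zero j M))

  firstRow : rowTerm c ≡ M zero c * cofactor M zero c
  firstRow = solve 3 (λ s a d → s :* (a :* d) := a :* (s :* d)) refl (sgn c) (M zero c) (det (minor zero c M))

  N : Fin (suc n) → Matrix (suc n)
  N i = minor (suc i) c M

  -- Expanding det M along row 0 and then each minor along column c gives the double sum of these
  -- terms; summing over j first yields the first-row expansion of minor (suc i) c M.
  term : Fin (suc n) → Fin (suc n) → ℚ
  term i j = M (suc i) c * altSign (toℕ (suc i) ℕ.+ toℕ c) * (sgn j * (N i zero j * det (minor zero j (N i))))

  expandMinor : ∀ j → rowTerm (punchIn c j) ≡ ∑ (λ i → term i j)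
  expandMinor j = begin
    s * (a * det M₀)
      ≡⟨ cong (λ d → s * (a * d)) (det-expandColumn M₀ c′) ⟩
    s * (a * ∑ (λ i → M₀ i c′ * cofactor M₀ i c′))
      ≡⟨ trans (cong (s *_) (*-distribˡ-∑ a (λ i → M₀ i c′ * cofactor M₀ i c′)))
               (*-distribˡ-∑ s (λ i → a * (M₀ i c′ * cofactor M₀ i c′))) ⟩
    ∑ (λ i → s * (a * (M₀ i c′ * cofactor M₀ i c′)))
      ≡⟨ ∑-cong reorder ⟩
    ∑ (λ i → term i j) ∎
    where
    s = sgn (punchIn c j)
    a = M zero (punchIn c j)
    M₀ = minor zero (punchIn c j) M
    c≢ = Fin.punchInᵢ≢i c j
    c′ = punchOut c≢
    reorder : ∀ i → s * (a * (M₀ i c′ * cofactor M₀ i c′)) ≡ term i j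
    reorder i = begin
      s * (a * (M (suc i) (punchIn (punchIn c j) c′)
                * (altSign (toℕ i ℕ.+ toℕ c′) * det (minor i c′ M₀))))
        ≡⟨ cong₂ (λ b d → s * (a * (b * d)))
                 (cong (M (suc i)) (Fin.punchIn-punchOut c≢))
                 (cong₂ _*_ (altSign-+ (toℕ i) (toℕ c′))
                            (det-cong (λ r k → cong (M (suc (punchIn i r))) (punchIn-exchange c j c≢ k)))) ⟩
      s * (a * (b * (sgn i * sgn c′ * d)))
        ≡⟨ solve 6 (λ s a b u t d → s :* (a :* (b :* (u :* t :* d))) := (s :* t) :* (b :* u :* (a :* d)))
                 refl s a b (sgn i) (sgn c′) d ⟩
      (s * sgn c′) * (b * sgn i * (a * d))
        ≡⟨ cong (λ x → x * (b * sgn i * (a * d))) (sgn-punchIn-punchOut c j c≢) ⟩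
      - (sgn c * sgn j) * (b * sgn i * (a * d))
        ≡⟨ solve 6 (λ c j b u a d → :- (c :* j) :* (b :* u :* (a :* d)) := b :* :- (u :* c) :* (j :* (a :* d)))
                 refl (sgn c) (sgn j) b (sgn i) a d ⟩
      b * - (sgn i * sgn c) * (sgn j * (a * d))
        ≡⟨ cong (λ x → b * x * (sgn j * (a * d)))
                (trans (altSign-suc (toℕ i ℕ.+ toℕ c)) (cong -_ (altSign-+ (toℕ i) (toℕ c)))) ⟨
      term i j ∎
      where
      b = M (suc i) c
      d = det (minor zero j (N i))

  collectColumn : ∀ i → ∑ (term i) ≡ M (suc i) c * cofactor M (suc i) c
  collectColumn i = begin
    ∑ (term i)           ≡⟨ *-distribˡ-∑ (b * σ) (λ j → sgn j * (N i zero j * det (minor zero j (N i)))) ⟨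
    b * σ * det (N i)    ≡⟨ *-assoc b σ (det (N i)) ⟩
    b * (σ * det (N i))  ∎
    where
    b = M (suc i) c
    σ = altSign (toℕ (suc i) ℕ.+ toℕ c)

  otherRows : ∑ (rowTerm ∘ punchIn c) ≡ ∑ (λ i → M (suc i) c * cofactor M (suc i) c)
  otherRows = begin
    ∑ (rowTerm ∘ punchIn c)              ≡⟨ ∑-cong expandMinor ⟩
    ∑ (λ j → ∑ (λ i → term i j))         ≡⟨ ∑-comm (λ j i → term i j) ⟩
    ∑ (λ i → ∑ (term i))                 ≡⟨ ∑-cong collectColumn ⟩
    ∑ (λ i → M (suc i) c * cofactor M (suc i) c) ∎

det-transpose : ∀ {n} (M : Matrix n) → det (λ i j → M j i) ≡ det M
det-transpose {zero}  M = refl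
det-transpose {suc n} M = begin
  ∑ (λ j → sgn j * (M j zero * det (λ r k → minor j zero M k r)))
    ≡⟨ ∑-cong (λ j → cong₂ (λ s d → s * (M j zero * d))
                            (cong altSign (sym (ℕ.+-identityʳ (toℕ j)))) (det-transpose (minor j zero M))) ⟩
  ∑ (λ j → altSign (toℕ j ℕ.+ 0) * (M j zero * det (minor j zero M)))
    ≡⟨ ∑-cong (λ j → solve 3 (λ s a d → s :* (a :* d) := a :* (s :* d))
                             refl (altSign (toℕ j ℕ.+ 0)) (M j zero) (det (minor j zero M))) ⟩
  ∑ (λ j → M j zero * cofactor M j zero)
    ≡⟨ det-expandColumn M zero ⟨
  det M ∎

replaceColumn : ∀ {n} → Matrix n → Fin n → (Fin n → ℚ) → Matrix n
replaceColumn M c v i j with j Fin.≟ c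
... | yes _ = v i
... | no  _ = M i j

replaceColumn-≡ : ∀ {n} (M : Matrix n) c v i → replaceColumn M c v i c ≡ v i
replaceColumn-≡ M c v i with c Fin.≟ c
... | yes _   = refl
... | no  c≢c = ⊥-elim (c≢c refl)

replaceColumn-≢ : ∀ {n} (M : Matrix n) c v i {j} → j ≢ c → replaceColumn M c v i j ≡ M i j
replaceColumn-≢ M c v i {j} j≢c with j Fin.≟ c
... | yes j≡c = ⊥-elim (j≢c j≡c)
... | no  _   = refl

det-replaceColumn : ∀ {n} (M : Matrix (suc n)) c v →
                    det (replaceColumn M c v) ≡ ∑ (λ i → v i * cofactor M i c)
det-replaceColumn M c v = trans (det-expandColumn (replaceColumn M c v) c) (∑-cong λ i →
  cong₂ (λ a d → a * (altSign (toℕ i ℕ.+ toℕ c) * d))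
        (replaceColumn-≡ M c v i)
        (det-cong (λ r k → replaceColumn-≢ M c v (punchIn i r) (Fin.punchInᵢ≢i c k))))

det₂ : (M : Matrix 2) → det M ≡ M zero zero * M (suc zero) (suc zero) - M zero (suc zero) * M (suc zero) zero
det₂ M = solve 4 (λ a b c d → con 1ℚ :* (a :* (con 1ℚ :* (d :* con 1ℚ) :+ con 0ℚ))
                              :+ (con (- 1ℚ) :* (b :* (con 1ℚ :* (c :* con 1ℚ) :+ con 0ℚ)) :+ con 0ℚ)
                              := a :* d :- b :* c)
                 refl (M zero zero) (M zero (suc zero)) (M (suc zero) zero) (M (suc zero) (suc zero))

avoid₂ : ∀ {n} (a b : Fin (3 ℕ.+ n)) → ∃[ c ] (c ≢ a × c ≢ b)
avoid₂ zero          zero          = suc zero , (λ ()) , (λ ())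
avoid₂ zero          (suc zero)    = suc (suc zero) , (λ ()) , (λ ())
avoid₂ zero          (suc (suc b)) = suc zero , (λ ()) , (λ ())
avoid₂ (suc zero)    zero          = suc (suc zero) , (λ ()) , (λ ())
avoid₂ (suc (suc a)) zero          = suc zero , (λ ()) , (λ ())
avoid₂ (suc a)       (suc b)       = zero , (λ ()) , (λ ())

det-equalColumns : ∀ {n} (M : Matrix n) {a b} → a ≢ b → (∀ i → M i a ≡ M i b) → det M ≡ 0ℚ
det-equalColumns {1} M {zero} {zero} a≢b _ = ⊥-elim (a≢b refl)
det-equalColumns {2} M {zero} {zero} a≢b _ = ⊥-elim (a≢b refl)
det-equalColumns {2} M {suc zero} {suc zero} a≢b _ = ⊥-elim (a≢b refl)
det-equalColumns {2} M {zero} {suc zero} _ Ma≡Mb = trans (det₂ M)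
  (trans (cong₂ (λ p q → p * M (suc zero) (suc zero) - M zero (suc zero) * q) (Ma≡Mb zero) (Ma≡Mb (suc zero)))
         (solve 2 (λ p q → p :* q :- p :* q := con 0ℚ) refl (M zero (suc zero)) (M (suc zero) (suc zero))))
det-equalColumns {2} M {suc zero} {zero} _ Ma≡Mb = trans (det₂ M)
  (trans (cong₂ (λ p q → M zero zero * p - q * M (suc zero) zero) (Ma≡Mb (suc zero)) (Ma≡Mb zero))
         (solve 2 (λ p q → p :* q :- p :* q := con 0ℚ) refl (M zero zero) (M (suc zero) zero)))
-- For n ≥ 3, expand along a third column c; every minor keeps two equal columns.
det-equalColumns {suc (suc (suc n))} M {a} {b} a≢b Ma≡Mb =
  let c , c≢a , c≢b = avoid₂ a b in trans (det-expandColumn M c) (∑-zero λ i →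
  trans (cong (λ d → M i c * (altSign (toℕ i ℕ.+ toℕ c) * d)) (det-equalColumns (minor i c M)
          (a≢b ∘ Fin.punchOut-injective c≢a c≢b)
          (λ r → trans (cong (M (punchIn i r)) (Fin.punchIn-punchOut c≢a))
                (trans (Ma≡Mb (punchIn i r)) (cong (M (punchIn i r)) (sym (Fin.punchIn-punchOut c≢b)))))))
        (solve 2 (λ p s → p :* (s :* con 0ℚ) := con 0ℚ) refl (M i c) (altSign (toℕ i ℕ.+ toℕ c))))

cofactor-alien : ∀ {n} (M : Matrix (suc n)) {c k} → k ≢ c → ∑ (λ i → M i k * cofactor M i c) ≡ 0ℚ
cofactor-alien M {c} {k} k≢c = trans (sym (det-replaceColumn M c (λ i → M i k)))
  (det-equalColumns (replaceColumn M c (λ i → M i k)) (k≢c ∘ sym)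
    (λ i → trans (replaceColumn-≡ M c _ i) (sym (replaceColumn-≢ M c _ i k≢c))))

det-addColumnCombination : ∀ {n} (M : Matrix n) c (z : Fin n → ℚ) → z c ≡ 0ℚ →
  det (replaceColumn M c (λ i → M i c + ∑ (λ k → z k * M i k))) ≡ det M
det-addColumnCombination {suc n} M c z zc≡0 = begin
  det (replaceColumn M c (λ i → M i c + combination i))
    ≡⟨ det-replaceColumn M c (λ i → M i c + combination i) ⟩
  ∑ (λ i → (M i c + combination i) * cof i)
    ≡⟨ ∑-cong (λ i → *-distribʳ-+ (cof i) (M i c) (combination i)) ⟩
  ∑ (λ i → M i c * cof i + combination i * cof i)
    ≡⟨ ∑-distrib-+ (λ i → M i c * cof i) (λ i → combination i * cof i) ⟩
  ∑ (λ i → M i c * cof i) + ∑ (λ i → combination i * cof i)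
    ≡⟨ cong₂ _+_ (det-expandColumn M c) combinationTerm ⟨
  det M + 0ℚ
    ≡⟨ +-identityʳ (det M) ⟩
  det M ∎
  where
  combination : Fin (suc n) → ℚ
  combination i = ∑ (λ k → z k * M i k)
  cof : Fin (suc n) → ℚ
  cof i = cofactor M i c
  columnTerm : ∀ k → z k * ∑ (λ i → M i k * cof i) ≡ 0ℚ
  columnTerm k with k Fin.≟ c
  ... | yes refl = trans (cong (_* ∑ (λ i → M i k * cof i)) zc≡0) (*-zeroˡ (∑ (λ i → M i k * cof i)))
  ... | no  k≢c  = trans (cong (z k *_) (cofactor-alien M k≢c)) (*-zeroʳ (z k))
  combinationTerm : 0ℚ ≡ ∑ (λ i → combination i * cof i)
  combinationTerm = sym (begin
    ∑ (λ i → combination i * cof i)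
      ≡⟨ ∑-cong (λ i → *-distribʳ-∑ (cof i) (λ k → z k * M i k)) ⟩
    ∑ (λ i → ∑ (λ k → z k * M i k * cof i))
      ≡⟨ ∑-comm (λ i k → z k * M i k * cof i) ⟩
    ∑ (λ k → ∑ (λ i → z k * M i k * cof i))
      ≡⟨ ∑-cong (λ k → trans (∑-cong (λ i → *-assoc (z k) (M i k) (cof i)))
                             (sym (*-distribˡ-∑ (z k) (λ i → M i k * cof i)))) ⟩
    ∑ (λ k → z k * ∑ (λ i → M i k * cof i))
      ≡⟨ ∑-zero columnTerm ⟩
    0ℚ ∎)

identityTimes-≡ : ∀ {n} x (i : Fin n) → identityTimes x i i ≡ x
identityTimes-≡ x i with i Fin.≟ i
... | yes _   = refl
... | no  i≢i = ⊥-elim (i≢i refl)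

identityTimes-≢ : ∀ {n} x {i j : Fin n} → i ≢ j → identityTimes x i j ≡ 0ℚ
identityTimes-≢ x {i} {j} i≢j with i Fin.≟ j
... | yes i≡j = ⊥-elim (i≢j i≡j)
... | no  _   = refl

identityTimes-injective : ∀ {a b} x (f : Fin a → Fin b) → (∀ {i j} → f i ≡ f j → i ≡ j) →
                          ∀ i j → identityTimes x (f i) (f j) ≡ identityTimes x i j
identityTimes-injective x f f-inj i j with i Fin.≟ j
... | yes refl = identityTimes-≡ x (f i)
... | no  i≢j  = identityTimes-≢ x (i≢j ∘ f-inj)

identityTimes-sym : ∀ {n} x (i j : Fin n) → identityTimes x i j ≡ identityTimes x j i
identityTimes-sym x i j with i Fin.≟ j
... | yes refl = sym (identityTimes-≡ x i)
... | no  i≢j  = sym (identityTimes-≢ x (i≢j ∘ sym))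

identityTimes-*ʳ : ∀ {n} x y (i j : Fin n) → identityTimes (x * y) i j ≡ identityTimes x i j * y
identityTimes-*ʳ x y i j with i Fin.≟ j
... | yes _ = refl
... | no  _ = sym (*-zeroˡ y)

identityTimes-minus : ∀ {n} x y (i j : Fin n) → identityTimes x i j - identityTimes y i j ≡ identityTimes (x - y) i j
identityTimes-minus x y i j with i Fin.≟ j
... | yes _ = refl
... | no  _ = refl

∑-*-identityTimes : ∀ {n} (g : Fin n → ℚ) c w → ∑ (λ u → g u * identityTimes c u w) ≡ g w * c
∑-*-identityTimes g c w = trans
  (∑-single (λ u → g u * identityTimes c u w) w
             (λ u u≢w → trans (cong (g u *_) (identityTimes-≢ c u≢w)) (*-zeroʳ (g u))))
  (cong (g w *_) (identityTimes-≡ c w))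

adj-mul : ∀ {n} (D : Matrix n) a b → ∑ (λ u → adj D a u * D u b) ≡ identityTimes (det D) a b
adj-mul {suc n} D a b = begin
  ∑ (λ u → adj D a u * D u b)          ≡⟨ ∑-cong transposeCofactor ⟩
  ∑ (λ u → D u b * cofactor D u a)     ≡⟨ expansion (a Fin.≟ b) ⟩
  identityTimes (det D) a b            ∎
  where
  transposeCofactor : ∀ u → adj D a u * D u b ≡ D u b * cofactor D u a
  transposeCofactor u = trans (*-comm (adj D a u) (D u b))
    (cong (λ k → D u b * (altSign k * det (minor u a D))) (ℕ.+-comm (toℕ a) (toℕ u)))
  expansion : Dec (a ≡ b) → ∑ (λ u → D u b * cofactor D u a) ≡ identityTimes (det D) a b
  expansion (yes refl) = trans (sym (det-expandColumn D a)) (sym (identityTimes-≡ (det D) a))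
  expansion (no a≢b)   = trans (cofactor-alien D (a≢b ∘ sym)) (sym (identityTimes-≢ (det D) a≢b))

punchIn-↑ˡ : ∀ {a} b (i : Fin (suc a)) (k : Fin a) → punchIn (i ↑ˡ b) (k ↑ˡ b) ≡ punchIn i k ↑ˡ b
punchIn-↑ˡ b zero    k       = refl
punchIn-↑ˡ b (suc i) zero    = refl
punchIn-↑ˡ b (suc i) (suc k) = cong suc (punchIn-↑ˡ b i k)

punchIn-↑ʳ : ∀ {a} b (i : Fin (suc a)) (k : Fin b) → punchIn (i ↑ˡ b) (a ↑ʳ k) ≡ suc a ↑ʳ k
punchIn-↑ʳ         b zero    k = refl
punchIn-↑ʳ {suc a} b (suc i) k = cong suc (punchIn-↑ʳ b i k)

det-blockLowerTriangular : ∀ a b (M : Matrix (a ℕ.+ b)) → (∀ i j → M (i ↑ˡ b) (a ↑ʳ j) ≡ 0ℚ) →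
  det M ≡ det (λ i j → M (i ↑ˡ b) (j ↑ˡ b)) * det (λ i j → M (a ↑ʳ i) (a ↑ʳ j))
det-blockLowerTriangular zero    b M _    = sym (*-identityˡ (det M))
det-blockLowerTriangular (suc a) b M M≡0 = begin
  det M
    ≡⟨ ∑-splitAt (suc a) rowTerm ⟩
  ∑ (λ i → rowTerm (i ↑ˡ b)) + ∑ (λ j → rowTerm (suc a ↑ʳ j))
    ≡⟨ cong₂ _+_ (∑-cong leftTerm) (∑-zero rightTerm) ⟩
  ∑ (λ i → sgn i * (L zero i * det (minor zero i L)) * det R) + 0ℚ
    ≡⟨ +-identityʳ _ ⟩
  ∑ (λ i → sgn i * (L zero i * det (minor zero i L)) * det R)
    ≡⟨ *-distribʳ-∑ (det R) (λ i → sgn i * (L zero i * det (minor zero i L))) ⟨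
  det L * det R ∎
  where
  rowTerm : Fin (suc a ℕ.+ b) → ℚ
  rowTerm j = sgn j * (M zero j * det (minor zero j M))
  L : Matrix (suc a)
  L i j = M (i ↑ˡ b) (j ↑ˡ b)
  R : Matrix b
  R i j = M (suc a ↑ʳ i) (suc a ↑ʳ j)
  rightTerm : ∀ j → rowTerm (suc a ↑ʳ j) ≡ 0ℚ
  rightTerm j = trans (cong (λ x → sgn (suc a ↑ʳ j) * (x * det (minor zero (suc a ↑ʳ j) M))) (M≡0 zero j))
    (solve 2 (λ s d → s :* (con 0ℚ :* d) := con 0ℚ) refl (sgn (suc a ↑ʳ j)) (det (minor zero (suc a ↑ʳ j) M)))
  leftTerm : ∀ i → rowTerm (i ↑ˡ b) ≡ sgn i * (L zero i * det (minor zero i L)) * det R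
  leftTerm i = begin
    sgn (i ↑ˡ b) * (L zero i * det (minor zero (i ↑ˡ b) M))
      ≡⟨ cong₂ (λ s d → s * (L zero i * d)) (cong altSign (Fin.toℕ-↑ˡ i b))
           (det-blockLowerTriangular a b (minor zero (i ↑ˡ b) M)
             (λ r k → trans (cong (M (suc (r ↑ˡ b))) (punchIn-↑ʳ b i k)) (M≡0 (suc r) k))) ⟩
    sgn i * (L zero i * (det (λ r k → M (suc (r ↑ˡ b)) (punchIn (i ↑ˡ b) (k ↑ˡ b)))
                        * det (λ r k → M (suc (a ↑ʳ r)) (punchIn (i ↑ˡ b) (a ↑ʳ k)))))
      ≡⟨ cong₂ (λ d e → sgn i * (L zero i * (d * e)))
           (det-cong (λ r k → cong (M (suc (r ↑ˡ b))) (punchIn-↑ˡ b i k)))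
           (det-cong (λ r k → cong (M (suc (a ↑ʳ r))) (punchIn-↑ʳ b i k))) ⟩
    sgn i * (L zero i * (det (minor zero i L) * det R))
      ≡⟨ solve 4 (λ s l d e → s :* (l :* (d :* e)) := s :* (l :* d) :* e) refl
           (sgn i) (L zero i) (det (minor zero i L)) (det R) ⟩
    sgn i * (L zero i * det (minor zero i L)) * det R ∎

det-blockUpperTriangular : ∀ a b (M : Matrix (a ℕ.+ b)) → (∀ i j → M (a ↑ʳ j) (i ↑ˡ b) ≡ 0ℚ) →
  det M ≡ det (λ i j → M (i ↑ˡ b) (j ↑ˡ b)) * det (λ i j → M (a ↑ʳ i) (a ↑ʳ j))
det-blockUpperTriangular a b M M≡0 = begin
  det M
    ≡⟨ det-transpose M ⟨
  det (λ i j → M j i)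
    ≡⟨ det-blockLowerTriangular a b (λ i j → M j i) M≡0 ⟩
  det (λ i j → M (j ↑ˡ b) (i ↑ˡ b)) * det (λ i j → M (a ↑ʳ j) (a ↑ʳ i))
    ≡⟨ cong₂ _*_ (det-transpose (λ i j → M (i ↑ˡ b) (j ↑ˡ b)))
                 (det-transpose (λ i j → M (a ↑ʳ i) (a ↑ʳ j))) ⟩
  det (λ i j → M (i ↑ˡ b) (j ↑ˡ b)) * det (λ i j → M (a ↑ʳ i) (a ↑ʳ j)) ∎

det-addLaterColumns : ∀ {n} (M : Matrix n) (Z : Fin n → Fin n → ℚ) →
  (∀ c k → toℕ k ℕ.≤ toℕ c → Z c k ≡ 0ℚ) →
  det (λ i c → M i c + ∑ (λ k → Z c k * M i k)) ≡ det M
det-addLaterColumns {n} M Z Z-later = begin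
  det (λ i c → M i c + ∑ (λ k → Z c k * M i k))  ≡⟨ det-cong (λ i c → addedUpTo-< {i = i} (Fin.toℕ<n c)) ⟨
  det (addedUpTo n)                               ≡⟨ det-addedUpTo n ⟩
  det M                                           ∎
  where
  -- Columns are modified from left to right; column c only draws on later columns, which are
  -- still untouched at that point.
  addedUpTo : ℕ → Matrix n
  addedUpTo r i c with toℕ c ℕ.<? r
  ... | yes _ = M i c + ∑ (λ k → Z c k * M i k)
  ... | no  _ = M i c

  addedUpTo-< : ∀ {r i c} → toℕ c ℕ.< r → addedUpTo r i c ≡ M i c + ∑ (λ k → Z c k * M i k)
  addedUpTo-< {r} {i} {c} c<r with toℕ c ℕ.<? r
  ... | yes _   = refl
  ... | no  c≮r = ⊥-elim (c≮r c<r)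

  addedUpTo-≮ : ∀ {r i c} → ¬ toℕ c ℕ.< r → addedUpTo r i c ≡ M i c
  addedUpTo-≮ {r} {i} {c} c≮r with toℕ c ℕ.<? r
  ... | yes c<r = ⊥-elim (c≮r c<r)
  ... | no  _   = refl

  addedUpTo-suc : ∀ {r i c} → toℕ c ≢ r → addedUpTo (suc r) i c ≡ addedUpTo r i c
  addedUpTo-suc {r} {i} {c} c≢r with toℕ c ℕ.<? suc r | toℕ c ℕ.<? r
  ... | yes _     | yes _   = refl
  ... | no  _     | no  _   = refl
  ... | yes c<1+r | no  c≮r = ⊥-elim (c≢r (ℕ.≤-antisym (ℕ.≤-pred c<1+r) (ℕ.≮⇒≥ c≮r)))
  ... | no  c≮1+r | yes c<r = ⊥-elim (c≮1+r (ℕ.m≤n⇒m≤1+n c<r))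

  addColumn : ∀ {r} (r<n : r ℕ.< n) (let c = Fin.fromℕ< r<n) →
              ∀ i j → addedUpTo (suc r) i j
                    ≡ replaceColumn (addedUpTo r) c (λ i → addedUpTo r i c + ∑ (λ k → Z c k * addedUpTo r i k)) i j
  addColumn {r} r<n i j with j Fin.≟ Fin.fromℕ< r<n
  ... | no  j≢c  = addedUpTo-suc (λ j≡r → j≢c (Fin.toℕ-injective (trans j≡r (sym (Fin.toℕ-fromℕ< r<n)))))
  ... | yes refl = begin
    addedUpTo (suc r) i j
      ≡⟨ addedUpTo-< (ℕ.≤-reflexive (cong suc c≡r)) ⟩
    M i j + ∑ (λ k → Z j k * M i k)
      ≡⟨ cong₂ _+_ (addedUpTo-≮ (ℕ.<-irrefl c≡r)) (∑-cong laterUnchanged) ⟨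
    addedUpTo r i j + ∑ (λ k → Z j k * addedUpTo r i k) ∎
    where
    c≡r : toℕ j ≡ r
    c≡r = Fin.toℕ-fromℕ< r<n
    laterUnchanged : ∀ k → Z j k * addedUpTo r i k ≡ Z j k * M i k
    laterUnchanged k with toℕ k ℕ.≤? toℕ j
    ... | yes k≤c rewrite Z-later j k k≤c = trans (*-zeroˡ (addedUpTo r i k)) (sym (*-zeroˡ (M i k)))
    ... | no  k≰c = cong (Z j k *_) (addedUpTo-≮ (λ k<r → k≰c (ℕ.<⇒≤ (subst (toℕ k ℕ.<_) (sym c≡r) k<r))))

  det-addedUpTo : ∀ r → det (addedUpTo r) ≡ det M
  det-addedUpTo zero    = det-cong (λ i c → addedUpTo-≮ {zero} {i} {c} (λ ()))
  det-addedUpTo (suc r) with r ℕ.<? n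
  ... | yes r<n = trans (det-cong (addColumn r<n))
                        (trans (det-addColumnCombination (addedUpTo r) c (Z c) (Z-later c c ℕ.≤-refl)) (det-addedUpTo r))
    where c = Fin.fromℕ< r<n
  ... | no  r≮n = trans (det-cong (λ i c → addedUpTo-suc {r} {i} {c}
                                             (λ c≡r → r≮n (subst (ℕ._< n) c≡r (Fin.toℕ<n c)))))
                        (det-addedUpTo r)

splitAt-elim : ∀ a {b} (P : Fin (a ℕ.+ b) → Set) → (∀ i → P (i ↑ˡ b)) → (∀ j → P (a ↑ʳ j)) → ∀ x → P x
splitAt-elim a {b} P left right x = subst P (Fin.join-splitAt a b x) (fromSplit (splitAt a x))
  where
  fromSplit : ∀ s → P (Fin.join a b s)
  fromSplit (inj₁ i) = left i
  fromSplit (inj₂ j) = right j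

↑ˡ≢↑ʳ : ∀ {a b} (i : Fin a) (j : Fin b) → i ↑ˡ b ≢ a ↑ʳ j
↑ˡ≢↑ʳ {a} {b} i j eq with trans (sym (Fin.splitAt-↑ˡ a i b)) (trans (cong (splitAt a) eq) (Fin.splitAt-↑ʳ a b j))
... | ()

det-schurComplement : ∀ a b (M : Matrix (a ℕ.+ b)) (W : Fin b → Fin a → ℚ) →
  (∀ k j → M (a ↑ʳ k) (j ↑ˡ b) + ∑ (λ k′ → W k′ j * M (a ↑ʳ k) (a ↑ʳ k′)) ≡ 0ℚ) →
  det M ≡ det (λ i j → M (i ↑ˡ b) (j ↑ˡ b) + ∑ (λ k → W k j * M (i ↑ˡ b) (a ↑ʳ k)))
          * det (λ k k′ → M (a ↑ʳ k) (a ↑ʳ k′))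
det-schurComplement a b M W cleared = begin
  det M
    ≡⟨ det-addLaterColumns M Z Z-later ⟨
  det M′
    ≡⟨ det-blockUpperTriangular a b M′ (λ j k →
         trans (cong (M (a ↑ʳ k) (j ↑ˡ b) +_) (Z-↑ˡ j (M (a ↑ʳ k)))) (cleared k j)) ⟩
  det (λ i j → M′ (i ↑ˡ b) (j ↑ˡ b)) * det (λ k k′ → M′ (a ↑ʳ k) (a ↑ʳ k′))
    ≡⟨ cong₂ _*_ (det-cong (λ i j → cong (M (i ↑ˡ b) (j ↑ˡ b) +_) (Z-↑ˡ j (M (i ↑ˡ b)))))
                 (det-cong (λ k k′ → trans (cong (M (a ↑ʳ k) (a ↑ʳ k′) +_) (Z-↑ʳ k′ (M (a ↑ʳ k))))
                                            (+-identityʳ (M (a ↑ʳ k) (a ↑ʳ k′))))) ⟩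
  det (λ i j → M (i ↑ˡ b) (j ↑ˡ b) + ∑ (λ k → W k j * M (i ↑ˡ b) (a ↑ʳ k)))
    * det (λ k k′ → M (a ↑ʳ k) (a ↑ʳ k′)) ∎
  where
  coefficient : Fin a ⊎ Fin b → Fin a ⊎ Fin b → ℚ
  coefficient (inj₁ j) (inj₂ k) = W k j
  coefficient _        _        = 0ℚ

  Z : Fin (a ℕ.+ b) → Fin (a ℕ.+ b) → ℚ
  Z c k = coefficient (splitAt a c) (splitAt a k)

  M′ : Matrix (a ℕ.+ b)
  M′ i c = M i c + ∑ (λ k → Z c k * M i k)

  Z-later : ∀ c k → toℕ k ℕ.≤ toℕ c → Z c k ≡ 0ℚ
  Z-later = splitAt-elim a _
    (λ j → splitAt-elim a _ (λ _ _ → fromLeftToLeft j) (λ k k≤j → ⊥-elim (ℕ.<⇒≱ (upper j k) k≤j)))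
    (λ k _ _ → fromRight k)
    where
    fromLeftToLeft : ∀ j {i} → Z (j ↑ˡ b) (i ↑ˡ b) ≡ 0ℚ
    fromLeftToLeft j {i} rewrite Fin.splitAt-↑ˡ a j b | Fin.splitAt-↑ˡ a i b = refl
    fromRight : ∀ k {x} → Z (a ↑ʳ k) x ≡ 0ℚ
    fromRight k rewrite Fin.splitAt-↑ʳ a b k = refl
    upper : ∀ j k → toℕ (j ↑ˡ b) ℕ.< toℕ (a ↑ʳ k)
    upper j k rewrite Fin.toℕ-↑ˡ j b | Fin.toℕ-↑ʳ a k = ℕ.≤-trans (Fin.toℕ<n j) (ℕ.m≤m+n a (toℕ k))

  Z-↑ˡ : ∀ j (f : Fin (a ℕ.+ b) → ℚ) → ∑ (λ k → Z (j ↑ˡ b) k * f k) ≡ ∑ (λ k → W k j * f (a ↑ʳ k))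
  Z-↑ˡ j f rewrite Fin.splitAt-↑ˡ a j b = begin
    ∑ (λ k → coefficient (inj₁ j) (splitAt a k) * f k)
      ≡⟨ ∑-splitAt a (λ k → coefficient (inj₁ j) (splitAt a k) * f k) ⟩
    ∑ (λ i → coefficient (inj₁ j) (splitAt a (i ↑ˡ b)) * f (i ↑ˡ b))
      + ∑ (λ k → coefficient (inj₁ j) (splitAt a (a ↑ʳ k)) * f (a ↑ʳ k))
      ≡⟨ cong₂ _+_ (∑-zero (λ i → trans (cong (λ s → coefficient (inj₁ j) s * f (i ↑ˡ b)) (Fin.splitAt-↑ˡ a i b))
                                        (*-zeroˡ (f (i ↑ˡ b)))))
                   (∑-cong (λ k → cong (λ s → coefficient (inj₁ j) s * f (a ↑ʳ k)) (Fin.splitAt-↑ʳ a b k))) ⟩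
    0ℚ + ∑ (λ k → W k j * f (a ↑ʳ k))
      ≡⟨ +-identityˡ (∑ (λ k → W k j * f (a ↑ʳ k))) ⟩
    ∑ (λ k → W k j * f (a ↑ʳ k)) ∎

  Z-↑ʳ : ∀ k (f : Fin (a ℕ.+ b) → ℚ) → ∑ (λ k′ → Z (a ↑ʳ k) k′ * f k′) ≡ 0ℚ
  Z-↑ʳ k f rewrite Fin.splitAt-↑ʳ a b k = ∑-zero (λ k′ → *-zeroˡ (f k′))

encodeH : ∀ n (m : Fin n → ℕ) (l : Fin n) → Fin (m l) → Fin (total n m)
encodeH (suc n) m zero    w = w ↑ˡ total n (m ∘ suc)
encodeH (suc n) m (suc l) w = m zero ↑ʳ encodeH n (m ∘ suc) l w

decodeH-↑ˡ : ∀ n (m : Fin (suc n) → ℕ) w → decodeH (suc n) m (w ↑ˡ total n (m ∘ suc)) ≡ (zero , w)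
decodeH-↑ˡ n m w rewrite Fin.splitAt-↑ˡ (m zero) w (total n (m ∘ suc)) = refl

decodeH-↑ʳ : ∀ n (m : Fin (suc n) → ℕ) k → let (l , w) = decodeH n (m ∘ suc) k in
             decodeH (suc n) m (m zero ↑ʳ k) ≡ (suc l , w)
decodeH-↑ʳ n m k rewrite Fin.splitAt-↑ʳ (m zero) (total n (m ∘ suc)) k = refl

decodeH-encodeH : ∀ n (m : Fin n → ℕ) l w → decodeH n m (encodeH n m l w) ≡ (l , w)
decodeH-encodeH (suc n) m zero    w = decodeH-↑ˡ n m w
decodeH-encodeH (suc n) m (suc l) w
  rewrite decodeH-↑ʳ n m (encodeH n (m ∘ suc) l w) | decodeH-encodeH n (m ∘ suc) l w = refl

encodeH-decodeH : ∀ n (m : Fin n → ℕ) k → let (l , w) = decodeH n m k in encodeH n m l w ≡ k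
encodeH-decodeH (suc n) m = splitAt-elim (m zero) _ left right
  where
  left : ∀ w → let (l , w′) = decodeH (suc n) m (w ↑ˡ total n (m ∘ suc)) in
                encodeH (suc n) m l w′ ≡ w ↑ˡ total n (m ∘ suc)
  left w rewrite decodeH-↑ˡ n m w = refl
  right : ∀ k → let (l , w) = decodeH (suc n) m (m zero ↑ʳ k) in encodeH (suc n) m l w ≡ m zero ↑ʳ k
  right k rewrite decodeH-↑ʳ n m k = cong (m zero ↑ʳ_) (encodeH-decodeH n (m ∘ suc) k)

encodeH-elim : ∀ n (m : Fin n → ℕ) (P : Fin (total n m) → Set) → (∀ l w → P (encodeH n m l w)) → ∀ k → P k
encodeH-elim n m P P-encodeH k = subst P (encodeH-decodeH n m k) (P-encodeH _ _)

encodeH-injective : ∀ n (m : Fin n → ℕ) {l l′ w w′} →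
                    encodeH n m l w ≡ encodeH n m l′ w′ → (l , w) ≡ (l′ , w′)
encodeH-injective n m {l} {l′} {w} {w′} eq =
  trans (sym (decodeH-encodeH n m l w)) (trans (cong (decodeH n m) eq) (decodeH-encodeH n m l′ w′))

∑-encodeH : ∀ n (m : Fin n → ℕ) (g : Fin (total n m) → ℚ) → ∑ g ≡ ∑ (λ l → ∑ (λ w → g (encodeH n m l w)))
∑-encodeH zero    m g = refl
∑-encodeH (suc n) m g = trans (∑-splitAt (m zero) g)
  (cong (∑ (λ w → g (w ↑ˡ total n (m ∘ suc))) +_) (∑-encodeH n (m ∘ suc) (λ k → g (m zero ↑ʳ k))))

blockEdge : ∀ {n} {m : Fin n → ℕ} → ((l : Fin n) → SignedGraph (m l)) →
            Σ (Fin n) (λ l → Fin (m l)) → Σ (Fin n) (λ l → Fin (m l)) → Maybe Sign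
blockEdge H (l , w) (l′ , w′) with l Fin.≟ l′
... | yes refl = edge (H l) w w′
... | no  _    = nothing

blockEdge-suc : ∀ {n} {m : Fin (suc n) → ℕ} (H : (l : Fin (suc n)) → SignedGraph (m l)) l w l′ w′ →
                blockEdge H (suc l , w) (suc l′ , w′) ≡ blockEdge (H ∘ suc) (l , w) (l′ , w′)
blockEdge-suc H l w l′ w′ with l Fin.≟ l′
... | yes refl = refl
... | no  _    = refl

disjointUnion : ∀ {n} {m : Fin n → ℕ} → ((l : Fin n) → SignedGraph (m l)) → EdgeFun (total n m)
disjointUnion {n} {m} H k k′ = blockEdge H (decodeH n m k) (decodeH n m k′)

charPoly-disjointUnion : ∀ {n} {m : Fin n → ℕ} (H : (l : Fin n) → SignedGraph (m l)) x →
                         charPolyE (disjointUnion H) x ≡ ∏ (λ l → charPoly (H l) x)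
charPoly-disjointUnion {zero}      H x = refl
charPoly-disjointUnion {suc n} {m} H x = begin
  det D
    ≡⟨ det-blockLowerTriangular (m zero) T D upperRight ⟩
  det (λ i j → D (i ↑ˡ T) (j ↑ˡ T)) * det (λ i j → D (m zero ↑ʳ i) (m zero ↑ʳ j))
    ≡⟨ cong₂ _*_ (det-cong upperLeft) (trans (det-cong lowerRight) (charPoly-disjointUnion (H ∘ suc) x)) ⟩
  charPoly (H zero) x * ∏ (λ l → charPoly (H (suc l)) x) ∎
  where
  T = total n (m ∘ suc)
  D = charMatrix (disjointUnion H) x
  upperRight : ∀ i j → D (i ↑ˡ T) (m zero ↑ʳ j) ≡ 0ℚ
  upperRight i j rewrite decodeH-↑ˡ n m i | decodeH-↑ʳ n m j | identityTimes-≢ x (↑ˡ≢↑ʳ i j) = refl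
  upperLeft : ∀ i j → D (i ↑ˡ T) (j ↑ˡ T) ≡ charMatrix (edge (H zero)) x i j
  upperLeft i j rewrite decodeH-↑ˡ n m i | decodeH-↑ˡ n m j =
    cong (_- entry (edge (H zero) i j)) (identityTimes-injective x (_↑ˡ T) (Fin.↑ˡ-injective T _ _) i j)
  lowerRight : ∀ i j → D (m zero ↑ʳ i) (m zero ↑ʳ j) ≡ charMatrix (disjointUnion (H ∘ suc)) x i j
  lowerRight i j rewrite decodeH-↑ʳ n m i | decodeH-↑ʳ n m j =
    cong₂ (λ d e → d - entry e) (identityTimes-injective x (m zero ↑ʳ_) (Fin.↑ʳ-injective (m zero) _ _) i j)
      (let (l , w) = decodeH n (m ∘ suc) i; (l′ , w′) = decodeH n (m ∘ suc) j in blockEdge-suc H l w l′ w′)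

signℚ-* : ∀ s t → signℚ (s *ˢ t) ≡ signℚ s * signℚ t
signℚ-* Sign.+ Sign.+ = refl
signℚ-* Sign.+ Sign.- = refl
signℚ-* Sign.- Sign.+ = refl
signℚ-* Sign.- Sign.- = refl

signℚ-*-self : ∀ s → signℚ s * signℚ s ≡ 1ℚ
signℚ-*-self Sign.+ = refl
signℚ-*-self Sign.- = refl

markingℚ : ∀ {n} → SignedGraph n → Fin n → ℚ
markingℚ G v = signℚ (marking (edge G) v)

charMatrix-sym : ∀ {m} (H : SignedGraph m) x i j → charMatrix (edge H) x i j ≡ charMatrix (edge H) x j i
charMatrix-sym H x i j = cong₂ (λ d e → d - entry e) (identityTimes-sym x i j) (symmetric H i j)

-- The row vector μᵀ (xI − A)⁻¹, with the inverse written as adj(xI − A) / f_H(x).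
coronalRow : ∀ {m} (H : SignedGraph m) x → charPoly H x ≢ 0ℚ → Fin m → ℚ
coronalRow H x f≢0 w =
  ∑ (λ u → markingℚ H u * adj (charMatrix (edge H) x) u w) * (1/ charPoly H x) {{≢-nonZero f≢0}}

coronalRow-charMatrix : ∀ {m} (H : SignedGraph m) x (f≢0 : charPoly H x ≢ 0ℚ) w →
  ∑ (λ w′ → coronalRow H x f≢0 w′ * charMatrix (edge H) x w w′) ≡ markingℚ H w
coronalRow-charMatrix {m} H x f≢0 w = begin
  ∑ (λ w′ → S w′ * f⁻¹ * D w w′)
    ≡⟨ ∑-cong (λ w′ → trans (cong (S w′ * f⁻¹ *_) (charMatrix-sym H x w w′))
                             (solve 3 (λ s i d → s :* i :* d := i :* (s :* d)) refl (S w′) f⁻¹ (D w′ w))) ⟩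
  ∑ (λ w′ → f⁻¹ * (S w′ * D w′ w))
    ≡⟨ *-distribˡ-∑ f⁻¹ (λ w′ → S w′ * D w′ w) ⟨
  f⁻¹ * ∑ (λ w′ → S w′ * D w′ w)
    ≡⟨ cong (f⁻¹ *_) rowTimesMatrix ⟩
  f⁻¹ * (μ w * charPoly H x)
    ≡⟨ solve 3 (λ i a d → i :* (a :* d) := a :* (i :* d)) refl f⁻¹ (μ w) (charPoly H x) ⟩
  μ w * (f⁻¹ * charPoly H x)
    ≡⟨ cong (μ w *_) (*-inverseˡ (charPoly H x) {{≢-nonZero f≢0}}) ⟩
  μ w * 1ℚ
    ≡⟨ *-identityʳ (μ w) ⟩
  μ w ∎
  where
  μ = markingℚ H
  D = charMatrix (edge H) x
  S : Fin m → ℚ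
  S w′ = ∑ (λ u → μ u * adj D u w′)
  f⁻¹ = (1/ charPoly H x) {{≢-nonZero f≢0}}
  rowTimesMatrix : ∑ (λ w′ → S w′ * D w′ w) ≡ μ w * charPoly H x
  rowTimesMatrix = begin
    ∑ (λ w′ → S w′ * D w′ w)
      ≡⟨ ∑-cong (λ w′ → *-distribʳ-∑ (D w′ w) (λ u → μ u * adj D u w′)) ⟩
    ∑ (λ w′ → ∑ (λ u → μ u * adj D u w′ * D w′ w))
      ≡⟨ ∑-comm (λ w′ u → μ u * adj D u w′ * D w′ w) ⟩
    ∑ (λ u → ∑ (λ w′ → μ u * adj D u w′ * D w′ w))
      ≡⟨ ∑-cong (λ u → trans (∑-cong (λ w′ → *-assoc (μ u) (adj D u w′) (D w′ w)))
                              (sym (*-distribˡ-∑ (μ u) (λ w′ → adj D u w′ * D w′ w)))) ⟩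
    ∑ (λ u → μ u * ∑ (λ w′ → adj D u w′ * D w′ w))
      ≡⟨ ∑-cong (λ u → cong (μ u *_) (adj-mul D u w)) ⟩
    ∑ (λ u → μ u * identityTimes (det D) u w)
      ≡⟨ ∑-*-identityTimes μ (det D) w ⟩
    μ w * charPoly H x ∎

coronalRow-marking : ∀ {m} (H : SignedGraph m) x (f≢0 : charPoly H x ≢ 0ℚ) →
  ∑ (λ w → coronalRow H x f≢0 w * markingℚ H w) ≡ coronal H x f≢0
coronalRow-marking {m} H x f≢0 = begin
  ∑ (λ w → S w * f⁻¹ * μ w)
    ≡⟨ ∑-cong (λ w → solve 3 (λ s i a → s :* i :* a := s :* a :* i) refl (S w) f⁻¹ (μ w)) ⟩
  ∑ (λ w → S w * μ w * f⁻¹)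
    ≡⟨ *-distribʳ-∑ f⁻¹ (λ w → S w * μ w) ⟨
  ∑ (λ w → S w * μ w) * f⁻¹
    ≡⟨ cong (_* f⁻¹) (begin
        ∑ (λ w → S w * μ w)
          ≡⟨ ∑-cong (λ w → *-distribʳ-∑ (μ w) (λ u → μ u * adj D u w)) ⟩
        ∑ (λ w → ∑ (λ u → μ u * adj D u w * μ w))
          ≡⟨ ∑-comm (λ w u → μ u * adj D u w * μ w) ⟩
        ∑ (λ u → ∑ (λ w → μ u * adj D u w * μ w))
          ≡⟨ ∑-cong (λ u → ∑-cong (λ w → *-assoc (μ u) (adj D u w) (μ w))) ⟩
        ∑ (λ u → ∑ (λ w → μ u * (adj D u w * μ w))) ∎) ⟩
  coronal H x f≢0 ∎
  where
  μ = markingℚ H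
  D = charMatrix (edge H) x
  S : Fin m → ℚ
  S w = ∑ (λ u → μ u * adj D u w)
  f⁻¹ = (1/ charPoly H x) {{≢-nonZero f≢0}}

module CoronaCharMatrix {n} {m : Fin n → ℕ} (G : SignedGraph n) (H : (l : Fin n) → SignedGraph (m l))
                        (x : ℚ) (f≢0 : ∀ l → charPoly (H l) x ≢ 0ℚ) where

  T : ℕ
  T = total n m

  M : Matrix (n ℕ.+ T)
  M = charMatrix (corona G H) x

  link : Fin n → (l : Fin n) → Fin (m l) → ℚ
  link i l w = identityTimes (markingℚ G i * markingℚ (H l) w) i l

  -- The matrix D⁻¹Bᵀ of the column operations: Bᵀ joins block l to v_l only, and D_l⁻¹ is symmetric.
  W : Fin T → Fin n → ℚ
  W k j = let (l , w) = decodeH n m k in identityTimes (markingℚ G j * coronalRow (H l) x (f≢0 l) w) l j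

  private
    decode-↑ˡ : ∀ i → decode n m (i ↑ˡ T) ≡ inj₁ i
    decode-↑ˡ i rewrite Fin.splitAt-↑ˡ n i T = refl

    decode-↑ʳ : ∀ k → decode n m (n ↑ʳ k) ≡ inj₂ (decodeH n m k)
    decode-↑ʳ k rewrite Fin.splitAt-↑ʳ n T k = refl

    entry-link : ∀ i l w → entry (coronaEdgeV G H (inj₁ i) (inj₂ (l , w))) ≡ link i l w
    entry-link i l w with i Fin.≟ l
    ... | yes _ = signℚ-* (marking (edge G) i) (marking (edge (H l)) w)
    ... | no  _ = refl

    entry-link′ : ∀ i l w → entry (coronaEdgeV G H (inj₂ (l , w)) (inj₁ i)) ≡ link i l w
    entry-link′ i l w with i Fin.≟ l
    ... | yes _ = signℚ-* (marking (edge G) i) (marking (edge (H l)) w)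
    ... | no  _ = refl

    coronaEdgeV-blocks : ∀ q q′ → coronaEdgeV G H (inj₂ q) (inj₂ q′) ≡ blockEdge H q q′
    coronaEdgeV-blocks (l , w) (l′ , w′) with l Fin.≟ l′
    ... | yes refl = refl
    ... | no  _    = refl

  M-↑ˡ↑ˡ : ∀ i j → M (i ↑ˡ T) (j ↑ˡ T) ≡ charMatrix (edge G) x i j
  M-↑ˡ↑ˡ i j = cong₂ (λ d e → d - entry e) (identityTimes-injective x (_↑ˡ T) (Fin.↑ˡ-injective T _ _) i j)
                                            (cong₂ (coronaEdgeV G H) (decode-↑ˡ i) (decode-↑ˡ j))

  M-↑ʳ↑ʳ : ∀ k k′ → M (n ↑ʳ k) (n ↑ʳ k′) ≡ charMatrix (disjointUnion H) x k k′
  M-↑ʳ↑ʳ k k′ = cong₂ (λ d e → d - entry e) (identityTimes-injective x (n ↑ʳ_) (Fin.↑ʳ-injective n _ _) k k′)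
    (trans (cong₂ (coronaEdgeV G H) (decode-↑ʳ k) (decode-↑ʳ k′))
           (coronaEdgeV-blocks (decodeH n m k) (decodeH n m k′)))

  M-↑ˡ-encodeH : ∀ i l w → M (i ↑ˡ T) (n ↑ʳ encodeH n m l w) ≡ - link i l w
  M-↑ˡ-encodeH i l w = trans (cong₂ _-_ (identityTimes-≢ x (↑ˡ≢↑ʳ i (encodeH n m l w)))
    (trans (cong entry (cong₂ (coronaEdgeV G H) (decode-↑ˡ i)
                              (trans (decode-↑ʳ _) (cong inj₂ (decodeH-encodeH n m l w)))))
           (entry-link i l w)))
    (+-identityˡ (- link i l w))

  M-encodeH-↑ˡ : ∀ l w j → M (n ↑ʳ encodeH n m l w) (j ↑ˡ T) ≡ - link j l w
  M-encodeH-↑ˡ l w j = trans (cong₂ _-_ (identityTimes-≢ x (↑ˡ≢↑ʳ j (encodeH n m l w) ∘ sym))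
    (trans (cong entry (cong₂ (coronaEdgeV G H)
                              (trans (decode-↑ʳ _) (cong inj₂ (decodeH-encodeH n m l w))) (decode-↑ˡ j)))
           (entry-link′ j l w)))
    (+-identityˡ (- link j l w))

  M-encodeH-encodeH : ∀ l w l′ w′ → M (n ↑ʳ encodeH n m l w) (n ↑ʳ encodeH n m l′ w′)
                        ≡ identityTimes x (encodeH n m l w) (encodeH n m l′ w′) - entry (blockEdge H (l , w) (l′ , w′))
  M-encodeH-encodeH l w l′ w′ = trans (M-↑ʳ↑ʳ _ _)
    (cong₂ (λ q q′ → identityTimes x (encodeH n m l w) (encodeH n m l′ w′) - entry (blockEdge H q q′))
           (decodeH-encodeH n m l w) (decodeH-encodeH n m l′ w′))

  M-sameBlock : ∀ l w w′ → M (n ↑ʳ encodeH n m l w) (n ↑ʳ encodeH n m l w′) ≡ charMatrix (edge (H l)) x w w′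
  M-sameBlock l w w′ = trans (M-encodeH-encodeH l w l w′)
    (cong₂ (λ d e → d - entry e) (identityTimes-injective x (encodeH n m l) encodeH-injectiveʳ w w′) sameBlock)
    where
    encodeH-injectiveʳ : ∀ {v v′} → encodeH n m l v ≡ encodeH n m l v′ → v ≡ v′
    encodeH-injectiveʳ eq with encodeH-injective n m eq
    ... | refl = refl
    sameBlock : blockEdge H (l , w) (l , w′) ≡ edge (H l) w w′
    sameBlock with l Fin.≟ l
    ... | yes refl = refl
    ... | no  l≢l  = ⊥-elim (l≢l refl)

  M-otherBlock : ∀ l w l′ w′ → l ≢ l′ → M (n ↑ʳ encodeH n m l w) (n ↑ʳ encodeH n m l′ w′) ≡ 0ℚ
  M-otherBlock l w l′ w′ l≢l′ = trans (M-encodeH-encodeH l w l′ w′)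
    (cong₂ (λ d e → d - entry e) (identityTimes-≢ x (l≢l′ ∘ ,-injectiveˡ ∘ encodeH-injective n m)) otherBlock)
    where
    otherBlock : blockEdge H (l , w) (l′ , w′) ≡ nothing
    otherBlock with l Fin.≟ l′
    ... | yes l≡l′ = ⊥-elim (l≢l′ l≡l′)
    ... | no  _    = refl

  W-encodeH : ∀ l w j → W (encodeH n m l w) j ≡ identityTimes (markingℚ G j * coronalRow (H l) x (f≢0 l) w) l j
  W-encodeH l w j = cong (λ (l , w) → identityTimes (markingℚ G j * coronalRow (H l) x (f≢0 l) w) l j)
                         (decodeH-encodeH n m l w)

  lowerLeft-cleared : ∀ k j → M (n ↑ʳ k) (j ↑ˡ T) + ∑ (λ k′ → W k′ j * M (n ↑ʳ k) (n ↑ʳ k′)) ≡ 0ℚ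
  lowerLeft-cleared k j =
    encodeH-elim n m (λ k → M (n ↑ʳ k) (j ↑ˡ T) + ∑ (λ k′ → W k′ j * M (n ↑ʳ k) (n ↑ʳ k′)) ≡ 0ℚ) cleared k
    where
    cleared : ∀ l w → let r = n ↑ʳ encodeH n m l w in M r (j ↑ˡ T) + ∑ (λ k′ → W k′ j * M r (n ↑ʳ k′)) ≡ 0ℚ
    cleared l w = begin
      M r (j ↑ˡ T) + ∑ (λ k′ → W k′ j * M r (n ↑ʳ k′))
        ≡⟨ cong₂ _+_ (M-encodeH-↑ˡ l w j) (∑-encodeH n m (λ k′ → W k′ j * M r (n ↑ʳ k′))) ⟩
      - link j l w + ∑ (λ l′ → ∑ (λ w′ → W (encodeH n m l′ w′) j * M r (n ↑ʳ encodeH n m l′ w′)))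
        ≡⟨ cong (- link j l w +_) (∑-single _ l otherBlocks) ⟩
      - link j l w + ∑ (λ w′ → W (encodeH n m l w′) j * M r (n ↑ʳ encodeH n m l w′))
        ≡⟨ cong (- link j l w +_) (∑-cong sameBlockTerm) ⟩
      - link j l w + ∑ (λ w′ → δ * (Y w′ * D w w′))
        ≡⟨ cong (- link j l w +_) (*-distribˡ-∑ δ (λ w′ → Y w′ * D w w′)) ⟨
      - link j l w + δ * ∑ (λ w′ → Y w′ * D w w′)
        ≡⟨ cong₂ (λ a b → - a + δ * b) linkEq (coronalRow-charMatrix (H l) x (f≢0 l) w) ⟩
      - (δ * μ) + δ * μ
        ≡⟨ solve 2 (λ d a → :- (d :* a) :+ d :* a := con 0ℚ) refl δ μ ⟩
      0ℚ ∎
      where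
      r = n ↑ʳ encodeH n m l w
      δ = identityTimes (markingℚ G j) l j
      μ = markingℚ (H l) w
      Y = coronalRow (H l) x (f≢0 l)
      D = charMatrix (edge (H l)) x
      linkEq : link j l w ≡ δ * μ
      linkEq = trans (identityTimes-*ʳ (markingℚ G j) μ j l) (cong (_* μ) (identityTimes-sym (markingℚ G j) j l))
      sameBlockTerm : ∀ w′ → W (encodeH n m l w′) j * M r (n ↑ʳ encodeH n m l w′) ≡ δ * (Y w′ * D w w′)
      sameBlockTerm w′ = trans (cong₂ _*_ (trans (W-encodeH l w′ j) (identityTimes-*ʳ (markingℚ G j) (Y w′) l j))
                                          (M-sameBlock l w w′))
                               (*-assoc δ (Y w′) (D w w′))
      otherBlocks : ∀ l′ → l′ ≢ l → ∑ (λ w′ → W (encodeH n m l′ w′) j * M r (n ↑ʳ encodeH n m l′ w′)) ≡ 0ℚ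
      otherBlocks l′ l′≢l = ∑-zero λ w′ →
        trans (cong (W (encodeH n m l′ w′) j *_) (M-otherBlock l w l′ w′ (l′≢l ∘ sym)))
        (*-zeroʳ (W (encodeH n m l′ w′) j))

  schurComplement : ∀ i j → M (i ↑ˡ T) (j ↑ˡ T) + ∑ (λ k → W k j * M (i ↑ˡ T) (n ↑ʳ k))
                              ≡ identityTimes (x - coronal (H j) x (f≢0 j)) i j - adjacency (edge G) i j
  schurComplement i j = begin
    M (i ↑ˡ T) (j ↑ˡ T) + ∑ (λ k → W k j * M (i ↑ˡ T) (n ↑ʳ k))
      ≡⟨ cong₂ _+_ (M-↑ˡ↑ˡ i j) (∑-encodeH n m (λ k → W k j * M (i ↑ˡ T) (n ↑ʳ k))) ⟩
    charMatrix (edge G) x i j + ∑ (λ l → ∑ (λ w → W (encodeH n m l w) j * M (i ↑ˡ T) (n ↑ʳ encodeH n m l w)))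
      ≡⟨ cong (charMatrix (edge G) x i j +_) (∑-single _ j otherBlocks) ⟩
    charMatrix (edge G) x i j + ∑ (λ w → W (encodeH n m j w) j * M (i ↑ˡ T) (n ↑ʳ encodeH n m j w))
      ≡⟨ cong (charMatrix (edge G) x i j +_) (∑-cong blockTerm) ⟩
    charMatrix (edge G) x i j + ∑ (λ w → - (δ * markingℚ G j) * (Y w * μ w))
      ≡⟨ cong (charMatrix (edge G) x i j +_) (*-distribˡ-∑ (- (δ * markingℚ G j)) (λ w → Y w * μ w)) ⟨
    charMatrix (edge G) x i j + - (δ * markingℚ G j) * ∑ (λ w → Y w * μ w)
      ≡⟨ cong (λ c → charMatrix (edge G) x i j + - (δ * markingℚ G j) * c) (coronalRow-marking (H j) x (f≢0 j)) ⟩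
    identityTimes x i j - a + - (δ * markingℚ G j) * χ
      ≡⟨ solve 4 (λ e a d c → e :- a :+ :- d :* c := e :- d :* c :- a)
                 refl (identityTimes x i j) a (δ * markingℚ G j) χ ⟩
    identityTimes x i j - δ * markingℚ G j * χ - a
      ≡⟨ cong (λ c → identityTimes x i j - c - a) diagonal ⟩
    identityTimes x i j - identityTimes χ i j - a
      ≡⟨ cong (_- a) (identityTimes-minus x χ i j) ⟩
    identityTimes (x - χ) i j - a ∎
    where
    a = adjacency (edge G) i j
    δ = identityTimes (markingℚ G i) i j
    μ = markingℚ (H j)
    Y = coronalRow (H j) x (f≢0 j)
    χ = coronal (H j) x (f≢0 j)
    blockTerm : ∀ w → W (encodeH n m j w) j * M (i ↑ˡ T) (n ↑ʳ encodeH n m j w) ≡ - (δ * markingℚ G j) * (Y w * μ w)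
    blockTerm w = trans (cong₂ _*_ (trans (W-encodeH j w j) (identityTimes-≡ _ j))
                                   (trans (M-↑ˡ-encodeH i j w) (cong -_ (identityTimes-*ʳ (markingℚ G i) (μ w) i j))))
      (solve 4 (λ c y d u → c :* y :* :- (d :* u) := :- (d :* c) :* (y :* u)) refl (markingℚ G j) (Y w) δ (μ w))
    otherBlocks : ∀ l → l ≢ j → ∑ (λ w → W (encodeH n m l w) j * M (i ↑ˡ T) (n ↑ʳ encodeH n m l w)) ≡ 0ℚ
    otherBlocks l l≢j = ∑-zero λ w →
      trans (cong (_* M (i ↑ˡ T) (n ↑ʳ encodeH n m l w)) (trans (W-encodeH l w j) (identityTimes-≢ _ l≢j)))
        (*-zeroˡ (M (i ↑ˡ T) (n ↑ʳ encodeH n m l w)))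
    diagonal : δ * markingℚ G j * χ ≡ identityTimes χ i j
    diagonal with i Fin.≟ j
    ... | yes refl = trans (cong (_* χ) (signℚ-*-self (marking (edge G) i))) (*-identityˡ χ)
    ... | no  _    = trans (cong (_* χ) (*-zeroˡ (markingℚ G j))) (*-zeroˡ χ)

mainTheorem13 : (n : ℕ) (G : SignedGraph n) (m : Fin n → ℕ)
                (H : (l : Fin n) → SignedGraph (m l)) (m' : ℕ) (H' : SignedGraph m') →
                (∀ l (x : ℚ) (p : charPoly (H l) x ≢ 0ℚ) (q : charPoly H' x ≢ 0ℚ) →
                   coronal (H l) x p ≡ coronal H' x q) →
                ∀ (x : ℚ) → (p : ∀ l → charPoly (H l) x ≢ 0ℚ) → (q : charPoly H' x ≢ 0ℚ) →
                charPolyE (corona G H) x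
                  ≡ ∏ (λ l → charPoly (H l) x) * charPoly G (x - coronal H' x q)
mainTheorem13 n G m H m' H' sameCoronal x p q = begin
  det M
    ≡⟨ det-schurComplement n T M W lowerLeft-cleared ⟩
  det (λ i j → M (i ↑ˡ T) (j ↑ˡ T) + ∑ (λ k → W k j * M (i ↑ˡ T) (n ↑ʳ k)))
    * det (λ k k′ → M (n ↑ʳ k) (n ↑ʳ k′))
    ≡⟨ cong₂ _*_ (det-cong commonCoronal) (trans (det-cong M-↑ʳ↑ʳ) (charPoly-disjointUnion H x)) ⟩
  charPoly G (x - coronal H' x q) * ∏ (λ l → charPoly (H l) x)
    ≡⟨ *-comm (charPoly G (x - coronal H' x q)) (∏ (λ l → charPoly (H l) x)) ⟩
  ∏ (λ l → charPoly (H l) x) * charPoly G (x - coronal H' x q) ∎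
  where
  open CoronaCharMatrix G H x p
  commonCoronal : ∀ i j → M (i ↑ˡ T) (j ↑ˡ T) + ∑ (λ k → W k j * M (i ↑ˡ T) (n ↑ʳ k))
                            ≡ charMatrix (edge G) (x - coronal H' x q) i j
  commonCoronal i j = trans (schurComplement i j)
    (cong (λ χ → identityTimes (x - χ) i j - adjacency (edge G) i j) (sameCoronal j x (p j) q))
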